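{- Let $\Gamma$ be a connected trivalent graph and $G\le\mathrm{Aut}(\Gamma)$ act vertex-transitively, but not edge-transitively, on $\Gamma$, with infinite vertex stabilizers. Then $\Gamma$ contains an infinite alternating line, and every alternating $s$-arc is contained in an infinite alternating line.
   Context: Graphs are simple. An $s$-arc is a tuple $(\alpha_0,\dots,\alpha_s)$ with each $\{\alpha_i,\alpha_{i+1}\}$ an edge and $\alpha_{i-1}\neq\alpha_{i+1}$ for $1\le i\le s-1$. Under the hypotheses, $G$ has exactly two orbits on edges and each vertex is incident with exactly one edge of one orbit (red) and two edges of the other (blue). An $s$-arc is alternating if consecutive edges have different colours. A line is a two-way infinite sequence $\dots,\alpha_{ -1},\alpha_0,\alpha_1,\dots$ of distinct vertices with each $\{\alpha_i,\alpha_{i+1}\}$ an edge; it is alternating if consecutive edges have different colours. -}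

module Defs where

open import Data.Nat using (ℕ; suc; _<_; _≤_)
open import Data.Integer as ℤ using (ℤ; +_)
open import Data.Product using (Σ; ∃; _×_; _,_)
open import Data.Sum using (_⊎_)
open import Data.List using (List)
open import Data.List.Relation.Unary.Any using (Any)
open import Relation.Nullary using (¬_)
open import Relation.Binary.PropositionalEquality using (_≡_; _≢_)
open import Relation.Binary.Construct.Closure.ReflexiveTransitive using (Star)
open import Function.Definitions using (Injective)

record Graph : Set₁ where
  field
    V       : Set
    _~_     : V → V → Set
    ~-sym   : ∀ {u v} → u ~ v → v ~ u
    ~-irrefl : ∀ {u} → ¬ (u ~ u)

module _ (Γ : Graph) where
  open Graph Γ

  Connected : Set
  Connected = ∀ u v → Star _~_ u v

  Trivalent : Set
  Trivalent = ∀ v → Σ V λ a → Σ V λ b → Σ V λ c →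
    (a ≢ b × a ≢ c × b ≢ c) × (v ~ a × v ~ b × v ~ c) ×
    (∀ w → v ~ w → w ≡ a ⊎ (w ≡ b ⊎ w ≡ c))

  record Aut : Set where
    field
      to      : V → V
      from    : V → V
      from-to : ∀ x → from (to x) ≡ x
      to-from : ∀ x → to (from x) ≡ x
      pres    : ∀ {u v} → u ~ v → to u ~ to v
      refl~   : ∀ {u v} → to u ~ to v → u ~ v
  open Aut public

  idAut : Aut
  idAut = record { to = λ x → x ; from = λ x → x ; from-to = λ _ → Relation.Binary.PropositionalEquality.refl
                 ; to-from = λ _ → Relation.Binary.PropositionalEquality.refl ; pres = λ p → p ; refl~ = λ p → p }

  _∘A_ : Aut → Aut → Aut
  g ∘A h = record
    { to = λ x → to g (to h x)
    ; from = λ x → from h (from g x)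
    ; from-to = λ x → Relation.Binary.PropositionalEquality.trans
        (Relation.Binary.PropositionalEquality.cong (from h) (from-to g (to h x))) (from-to h x)
    ; to-from = λ x → Relation.Binary.PropositionalEquality.trans
        (Relation.Binary.PropositionalEquality.cong (to g) (to-from h (from g x))) (to-from g x)
    ; pres = λ p → pres g (pres h p)
    ; refl~ = λ p → refl~ h (refl~ g p) }

  invAut : Aut → Aut
  invAut g = record
    { to = from g ; from = to g ; from-to = to-from g ; to-from = from-to g
    ; pres = λ {u} {v} p → refl~ g (Relation.Binary.PropositionalEquality.subst₂ _~_
        (Relation.Binary.PropositionalEquality.sym (to-from g u))
        (Relation.Binary.PropositionalEquality.sym (to-from g v)) p)
    ; refl~ = λ {u} {v} p → Relation.Binary.PropositionalEquality.subst₂ _~_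
        (to-from g u) (to-from g v) (pres g p) }

  record IsSubgroup (G : Aut → Set) : Set where
    field
      id-closed  : G idAut
      ∘-closed   : ∀ {g h} → G g → G h → G (g ∘A h)
      inv-closed : ∀ {g} → G g → G (invAut g)

  module _ (G : Aut → Set) where

    VertexTransitive : Set
    VertexTransitive = ∀ u v → Σ Aut λ g → G g × to g u ≡ v

    MapsEdge : Aut → V → V → V → V → Set
    MapsEdge g u v x y = (to g u ≡ x × to g v ≡ y) ⊎ (to g u ≡ y × to g v ≡ x)

    -- the edges {u,v} and {x,y} lie in the same G-orbit (i.e. have the same colour)
    SameOrbit : V → V → V → V → Set
    SameOrbit u v x y = Σ Aut λ g → G g × MapsEdge g u v x y

    EdgeTransitive : Set
    EdgeTransitive = ∀ u v x y → u ~ v → x ~ y → SameOrbit u v x y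

    -- the stabilizer G_v is finite: finitely many elements up to (pointwise) equality of maps
    FiniteStabilizer : V → Set
    FiniteStabilizer v = Σ (List Aut) λ hs →
      ∀ g → G g → to g v ≡ v → Any (λ h → ∀ x → to g x ≡ to h x) hs

    InfiniteStabilizer : V → Set
    InfiniteStabilizer v = ¬ FiniteStabilizer v

    -- α₀,…,αₛ (the values α i for i ≤ s) form an alternating s-arc
    AltArc : ℕ → (ℕ → V) → Set
    AltArc s α =
      (∀ i → i < s → α i ~ α (suc i)) ×
      (∀ i → suc i < s → α i ≢ α (suc (suc i))) ×
      (∀ i → suc i < s → ¬ SameOrbit (α i) (α (suc i)) (α (suc i)) (α (suc (suc i))))

    AltLine : (ℤ → V) → Set
    AltLine L =
      Injective _≡_ _≡_ L ×
      (∀ i → L i ~ L (i ℤ.+ + 1)) ×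
      (∀ i → ¬ SameOrbit (L i) (L (i ℤ.+ + 1)) (L (i ℤ.+ + 1)) (L (i ℤ.+ + 2)))

  ArcInLine : ℕ → (ℕ → V) → (ℤ → V) → Set
  ArcInLine s α L = Σ ℤ λ k → ∀ i → i ≤ s → L (k ℤ.+ + i) ≡ α i

-- Vertex-transitivity rules out all three edges at a vertex being alike (G would be
-- edge-transitive) or pairwise unalike (stabilisers would be trivial, by connectivity), so each
-- vertex x has one red neighbour ρ x and two blue ones, and G preserves the colouring.
-- Alternating walks beginning with a red edge are the walks of the digraph with x ⇒ y when y is
-- a blue neighbour of ρ x. By induction on k, G is transitive on walks of length k and the
-- stabiliser of such a walk moves a successor of its last vertex: otherwise an element fixing
-- one k-walk fixes its successors, hence by connectivity every vertex, and the stabiliser of a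
-- vertex would be determined by the image of a single k-walk, of which there are finitely many.
-- So a walk never returns to its start x or to ρ x (the element fixing the walk up to its last
-- step would fix that step, hence both successors), which makes every alternating sequence
-- injective; an alternating arc then extends in both directions to an alternating line.

module Submission where

open import Defs
open import Axiom.ExcludedMiddle using (ExcludedMiddle)
open import Level using (0ℓ)
open import Data.Bool using (Bool; true; false; not)
open import Data.Bool.Properties using (¬-not)
open import Data.Empty using (⊥; ⊥-elim)
open import Data.Product using (Σ; _×_; _,_; proj₁; proj₂)
open import Data.Sum using (_⊎_; inj₁; inj₂; [_,_]′; map₂; swap; assocˡ)
open import Data.List using (List; []; _∷_; map; _++_)
open import Data.Nat using (ℕ; zero; suc; _+_; _<_; _≤_; z≤n; s≤s)
open import Data.Nat.Properties using (≤-refl; m<n⇒m<1+n; m≤n⇒m≤1+n)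
import Data.Nat.Properties as ℕ
open import Data.Integer as ℤ using (ℤ; +_; -[1+_])
import Data.Integer.Properties as ℤP
open import Algebra.Bundles using (AbelianGroup)
open import Algebra.Properties.Group (AbelianGroup.group ℤP.+-0-abelianGroup) using (\\-leftDividesˡ; //-rightDividesʳ)
open import Data.List.Relation.Unary.Any as Any using (Any; here)
open import Data.List.Relation.Unary.Any.Properties using (map⁺; ++⁺ˡ; ++⁺ʳ)
open import Relation.Nullary using (¬_; Dec; yes; no)
open import Relation.Binary.PropositionalEquality
open import Function using (id; _∘_; _∘′_)
open import Relation.Binary.Construct.Closure.ReflexiveTransitive using (Star; ε; _◅_)
open import Relation.Binary.Construct.Closure.Transitive using (TransClosure; [_]; _∷_)

module _ {Γ : Graph} where
  open Graph Γ

  from-inverse : (g : Aut Γ) {u x : V} → to g u ≡ x → from g x ≡ u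
  from-inverse g {u} refl = from-to g u

  to-injective : (g : Aut Γ) {u v : V} → to g u ≡ to g v → u ≡ v
  to-injective g {u} {v} eq = trans (sym (from-inverse g eq)) (from-to g v)

  pres-≡ : (g : Aut Γ) {u v x y : V} → u ~ v → to g u ≡ x → to g v ≡ y → x ~ y
  pres-≡ g uv refl refl = pres g uv

infixr 5 _◂_
_◂_ : {A : Set} → A → (ℕ → A) → ℕ → A
(x ◂ w) zero = x
(x ◂ w) (suc i) = w i

ℤ-split : ∀ a b → a ≡ b ⊎ (Σ ℕ λ n → b ≡ a ℤ.+ + suc n) ⊎ (Σ ℕ λ n → a ≡ b ℤ.+ + suc n)
ℤ-split a b with ℤ.- a ℤ.+ b | \\-leftDividesˡ a b
... | + zero | a+d≡b = inj₁ (trans (sym (ℤP.+-identityʳ a)) a+d≡b)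
... | + suc n | a+d≡b = inj₂ (inj₁ (n , sym a+d≡b))
... | -[1+ n ] | a+d≡b = inj₂ (inj₂ (n , trans (sym (//-rightDividesʳ -[1+ n ] a)) (cong (ℤ._+ + suc n) a+d≡b)))

module SameOrbitProperties {Γ : Graph} {G : Aut Γ → Set} (sub : IsSubgroup Γ G) where
  open Graph Γ
  open IsSubgroup sub

  SameOrbit-refl : ∀ u v → SameOrbit Γ G u v u v
  SameOrbit-refl u v = idAut Γ , id-closed , inj₁ (refl , refl)

  SameOrbit-swap : ∀ u v → SameOrbit Γ G u v v u
  SameOrbit-swap u v = idAut Γ , id-closed , inj₂ (refl , refl)

  SameOrbit-image : ∀ {g u v x y} → G g → to g u ≡ x → to g v ≡ y → SameOrbit Γ G u v x y
  SameOrbit-image {g} Gg gu gv = g , Gg , inj₁ (gu , gv)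

  SameOrbit-sym : ∀ {u v x y} → SameOrbit Γ G u v x y → SameOrbit Γ G x y u v
  SameOrbit-sym (g , Gg , inj₁ (p , q)) = invAut Γ g , inv-closed Gg , inj₁ (from-inverse g p , from-inverse g q)
  SameOrbit-sym (g , Gg , inj₂ (p , q)) = invAut Γ g , inv-closed Gg , inj₂ (from-inverse g q , from-inverse g p)

  SameOrbit-trans : ∀ {u v x y a b} → SameOrbit Γ G u v x y → SameOrbit Γ G x y a b → SameOrbit Γ G u v a b
  SameOrbit-trans (g , Gg , m) (h , Gh , m′) = _∘A_ Γ h g , ∘-closed Gh Gg , compose m m′
    where
    compose : ∀ {u v x y a b} → MapsEdge Γ G g u v x y → MapsEdge Γ G h x y a b →
              MapsEdge Γ G (_∘A_ Γ h g) u v a b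
    compose (inj₁ (refl , refl)) (inj₁ e) = inj₁ e
    compose (inj₁ (refl , refl)) (inj₂ e) = inj₂ e
    compose (inj₂ (refl , refl)) (inj₁ (p , q)) = inj₂ (q , p)
    compose (inj₂ (refl , refl)) (inj₂ (p , q)) = inj₁ (q , p)

  SameOrbit-transport : ∀ {g u v x y u′ v′ x′ y′} → G g →
    to g u ≡ u′ → to g v ≡ v′ → to g x ≡ x′ → to g y ≡ y′ →
    SameOrbit Γ G u v x y → SameOrbit Γ G u′ v′ x′ y′
  SameOrbit-transport Gg gu gv gx gy s =
    SameOrbit-trans (SameOrbit-sym (SameOrbit-image Gg gu gv)) (SameOrbit-trans s (SameOrbit-image Gg gx gy))

data Colour : Set where
  red blue : Colour

other : Colour → Colour
other red = blue
other blue = red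

other-involutive : ∀ c → other (other c) ≡ c
other-involutive red = refl
other-involutive blue = refl

≢other : ∀ c → c ≢ other c
≢other red ()
≢other blue ()

colourAt : Colour → ℕ → Colour
colourAt c zero = c
colourAt c (suc j) = colourAt (other c) j

colourAt-suc : ∀ c j → colourAt c (suc j) ≡ other (colourAt c j)
colourAt-suc c zero = refl
colourAt-suc c (suc j) = colourAt-suc (other c) j

module VertexTransitiveAction {Γ : Graph} {G : Aut Γ → Set} (sub : IsSubgroup Γ G)
  (vt : VertexTransitive Γ G) where
  open Graph Γ
  open IsSubgroup sub
  open SameOrbitProperties sub

  AllAlike : V → Set
  AllAlike x = ∀ p q → x ~ p → x ~ q → SameOrbit Γ G x p x q

  AllUnalike : V → Set
  AllUnalike x = ∀ p q → x ~ p → x ~ q → p ≢ q → ¬ SameOrbit Γ G x p x q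

  allAlike⇒edgeTransitive : ∀ x → AllAlike x → EdgeTransitive Γ G
  allAlike⇒edgeTransitive x alike u v u′ v′ uv u′v′ with vt u x | vt u′ x
  ... | g , Gg , gu | h , Gh , hu′ =
    SameOrbit-trans (SameOrbit-image Gg gu refl)
      (SameOrbit-trans (alike _ _ (pres-≡ g uv gu refl) (pres-≡ h u′v′ hu′ refl))
        (SameOrbit-sym (SameOrbit-image Gh hu′ refl)))

  allUnalike-transport : ∀ x → AllUnalike x → ∀ y → AllUnalike y
  allUnalike-transport x unalike y p q yp yq p≢q pq with vt y x
  ... | g , Gg , gy =
    unalike (to g p) (to g q) (pres-≡ g yp gy refl) (pres-≡ g yq gy refl) (p≢q ∘′ to-injective g)
      (SameOrbit-transport Gg gy refl gy refl pq)

  allUnalike⇒trivialStabiliser : ExcludedMiddle 0ℓ → Connected Γ → ∀ x → AllUnalike x → FiniteStabilizer Γ G x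
  allUnalike⇒trivialStabiliser em connected x unalike =
    idAut Γ ∷ [] , λ h Gh hx → here (λ z → fixes-reachable Gh (connected x z) hx)
    where
    fixes-neighbour : ∀ {h y p} → G h → to h y ≡ y → y ~ p → to h p ≡ p
    fixes-neighbour {h} {y} {p} Gh hy yp with em {to h p ≡ p}
    ... | yes hp = hp
    ... | no hp≢p = ⊥-elim (allUnalike-transport x unalike y p (to h p) yp (pres-≡ h yp hy refl)
                              (hp≢p ∘′ sym) (SameOrbit-image Gh hy refl))

    fixes-reachable : ∀ {h y z} → G h → Star _~_ y z → to h y ≡ y → to h z ≡ z
    fixes-reachable Gh ε hy = hy
    fixes-reachable Gh (yw ◅ wz) hy = fixes-reachable Gh wz (fixes-neighbour Gh hy yw)

module VertexNotEdgeTransitive (em : ExcludedMiddle 0ℓ) {Γ : Graph} (connected : Connected Γ)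
  (trivalent : Trivalent Γ) {G : Aut Γ → Set} (sub : IsSubgroup Γ G) (vt : VertexTransitive Γ G)
  (¬et : ¬ EdgeTransitive Γ G) (infinite : ∀ v → InfiniteStabilizer Γ G v) where
  open Graph Γ
  open IsSubgroup sub
  open SameOrbitProperties sub
  open VertexTransitiveAction sub vt
  open ≡-Reasoning

  record LocalColouring (x : V) : Set where
    field
      r b₁ b₂ : V
      adj-r : x ~ r
      adj-b₁ : x ~ b₁
      adj-b₂ : x ~ b₂
      r≢b₁ : r ≢ b₁
      r≢b₂ : r ≢ b₂
      b₁≢b₂ : b₁ ≢ b₂
      neighbours : ∀ w → x ~ w → w ≡ r ⊎ (w ≡ b₁ ⊎ w ≡ b₂)
      b₁b₂-alike : SameOrbit Γ G x b₁ x b₂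
      rb₁-unalike : ¬ SameOrbit Γ G x r x b₁

  opaque
    localColouring : ∀ x → LocalColouring x
    localColouring x with trivalent x
    ... | a , b , c , (a≢b , a≢c , b≢c) , (xa , xb , xc) , nbrs
        with em {SameOrbit Γ G x a x b} | em {SameOrbit Γ G x a x c} | em {SameOrbit Γ G x b x c}
    ... | yes ab | yes ac | _ = ⊥-elim (¬et (allAlike⇒edgeTransitive x alike))
      where
      alike-a : ∀ p → x ~ p → SameOrbit Γ G x p x a
      alike-a p xp with nbrs p xp
      ... | inj₁ refl = SameOrbit-refl x a
      ... | inj₂ (inj₁ refl) = SameOrbit-sym ab
      ... | inj₂ (inj₂ refl) = SameOrbit-sym ac
      alike : AllAlike x
      alike p q xp xq = SameOrbit-trans (alike-a p xp) (SameOrbit-sym (alike-a q xq))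
    ... | yes ab | no ¬ac | _ = record
      { r = c ; b₁ = a ; b₂ = b ; adj-r = xc ; adj-b₁ = xa ; adj-b₂ = xb
      ; r≢b₁ = a≢c ∘′ sym ; r≢b₂ = b≢c ∘′ sym ; b₁≢b₂ = a≢b
      ; neighbours = λ w xw → swap (assocˡ (nbrs w xw)) ; b₁b₂-alike = ab
      ; rb₁-unalike = ¬ac ∘′ SameOrbit-sym }
    ... | no ¬ab | yes ac | _ = record
      { r = b ; b₁ = a ; b₂ = c ; adj-r = xb ; adj-b₁ = xa ; adj-b₂ = xc
      ; r≢b₁ = a≢b ∘′ sym ; r≢b₂ = b≢c ; b₁≢b₂ = a≢c
      ; neighbours = λ w xw → [ inj₂ ∘ inj₁ , map₂ inj₂ ]′ (nbrs w xw) ; b₁b₂-alike = ac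
      ; rb₁-unalike = ¬ab ∘′ SameOrbit-sym }
    ... | no ¬ab | no ¬ac | yes bc = record
      { r = a ; b₁ = b ; b₂ = c ; adj-r = xa ; adj-b₁ = xb ; adj-b₂ = xc
      ; r≢b₁ = a≢b ; r≢b₂ = a≢c ; b₁≢b₂ = b≢c
      ; neighbours = nbrs ; b₁b₂-alike = bc ; rb₁-unalike = ¬ab }
    ... | no ¬ab | no ¬ac | no ¬bc =
      ⊥-elim (infinite x (allUnalike⇒trivialStabiliser em connected x unalike))
      where
      unalike : AllUnalike x
      unalike p q xp xq p≢q with nbrs p xp | nbrs q xq
      ... | inj₁ refl | inj₁ refl = ⊥-elim (p≢q refl)
      ... | inj₁ refl | inj₂ (inj₁ refl) = ¬ab
      ... | inj₁ refl | inj₂ (inj₂ refl) = ¬ac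
      ... | inj₂ (inj₁ refl) | inj₁ refl = ¬ab ∘′ SameOrbit-sym
      ... | inj₂ (inj₁ refl) | inj₂ (inj₁ refl) = ⊥-elim (p≢q refl)
      ... | inj₂ (inj₁ refl) | inj₂ (inj₂ refl) = ¬bc
      ... | inj₂ (inj₂ refl) | inj₁ refl = ¬ac ∘′ SameOrbit-sym
      ... | inj₂ (inj₂ refl) | inj₂ (inj₁ refl) = ¬bc ∘′ SameOrbit-sym
      ... | inj₂ (inj₂ refl) | inj₂ (inj₂ refl) = ⊥-elim (p≢q refl)

  private
    module At x = LocalColouring (localColouring x)

  ρ : V → V
  ρ x = At.r x

  β : Bool → V → V
  β true x = At.b₁ x
  β false x = At.b₂ x

  adj-ρ : ∀ x → x ~ ρ x
  adj-ρ x = At.adj-r x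

  adj-β : ∀ b x → x ~ β b x
  adj-β true x = At.adj-b₁ x
  adj-β false x = At.adj-b₂ x

  ρ≢β : ∀ b x → ρ x ≢ β b x
  ρ≢β true x = At.r≢b₁ x
  ρ≢β false x = At.r≢b₂ x

  β-distinct : ∀ b x → β b x ≢ β (not b) x
  β-distinct true x = At.b₁≢b₂ x
  β-distinct false x = At.b₁≢b₂ x ∘′ sym

  ρ-or-β : ∀ x w → x ~ w → w ≡ ρ x ⊎ Σ Bool λ b → w ≡ β b x
  ρ-or-β x w xw = map₂ [ (true ,_) , (false ,_) ]′ (At.neighbours x w xw)

  ≢ρ⇒β : ∀ x w → x ~ w → w ≢ ρ x → Σ Bool λ b → w ≡ β b x
  ≢ρ⇒β x w xw w≢ρ = [ ⊥-elim ∘ w≢ρ , id ]′ (ρ-or-β x w xw)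

  β-alike : ∀ b b′ x → SameOrbit Γ G x (β b x) x (β b′ x)
  β-alike true true x = SameOrbit-refl _ _
  β-alike true false x = At.b₁b₂-alike x
  β-alike false true x = SameOrbit-sym (At.b₁b₂-alike x)
  β-alike false false x = SameOrbit-refl _ _

  ρβ-unalike : ∀ b x → ¬ SameOrbit Γ G x (ρ x) x (β b x)
  ρβ-unalike true x = At.rb₁-unalike x
  ρβ-unalike false x = At.rb₁-unalike x ∘′ (λ s → SameOrbit-trans s (β-alike false true x))

  -- The preimage of ρ (g x) is a neighbour of x; were it blue, g would carry the alike blue
  -- pair of x to a pair containing ρ (g x).
  ρ-equivariant : ∀ {g} → G g → ∀ x → to g (ρ x) ≡ ρ (to g x)
  ρ-equivariant {g} Gg x with ρ-or-β x (from g (ρ (to g x))) preimage-adjacent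
    where
    preimage-adjacent : x ~ from g (ρ (to g x))
    preimage-adjacent = refl~ g (subst (to g x ~_) (sym (to-from g _)) (adj-ρ (to g x)))
  ... | inj₁ w≡ρ = trans (cong (to g) (sym w≡ρ)) (to-from g _)
  ... | inj₂ (b , w≡β) = ⊥-elim (blue-image≢ρ (trans (cong (to g) (sym w≡β)) (to-from g _)))
    where
    blue-image≢ρ : to g (β b x) ≢ ρ (to g x)
    blue-image≢ρ gβ≡ρ with ≢ρ⇒β (to g x) (to g (β (not b) x)) (pres g (adj-β (not b) x))
                             (λ e → β-distinct b x (to-injective g (trans gβ≡ρ (sym e))))
    ... | c , gβ′≡β =
      ρβ-unalike c (to g x) (SameOrbit-transport Gg refl gβ≡ρ refl gβ′≡β (β-alike b (not b) x))

  β-equivariant : ∀ {g} → G g → ∀ b x → Σ Bool λ c → to g (β b x) ≡ β c (to g x)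
  β-equivariant {g} Gg b x = ≢ρ⇒β (to g x) (to g (β b x)) (pres g (adj-β b x))
    (λ e → ρ≢β b x (to-injective g (trans (ρ-equivariant Gg x) (sym e))))

  Edge : Colour → V → V → Set
  Edge red u v = v ≡ ρ u
  Edge blue u v = Σ Bool λ b → v ≡ β b u

  Edge-adjacent : ∀ c {u v} → Edge c u v → u ~ v
  Edge-adjacent red refl = adj-ρ _
  Edge-adjacent blue (b , refl) = adj-β b _

  colourOf : ∀ {u v} → u ~ v → Σ Colour λ c → Edge c u v
  colourOf {u} {v} uv = [ (red ,_) , (blue ,_) ]′ (ρ-or-β u v uv)

  Edge-unique : ∀ {c c′ u v} → Edge c u v → Edge c′ u v → c ≡ c′
  Edge-unique {red} {red} _ _ = refl
  Edge-unique {red} {blue} refl (b , e) = ⊥-elim (ρ≢β b _ e)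
  Edge-unique {blue} {red} (b , e) refl = ⊥-elim (ρ≢β b _ e)
  Edge-unique {blue} {blue} _ _ = refl

  Edge-image : ∀ {g} → G g → ∀ c {u v} → Edge c u v → Edge c (to g u) (to g v)
  Edge-image Gg red {u} refl = ρ-equivariant Gg u
  Edge-image Gg blue {u} (b , refl) with β-equivariant Gg b u
  ... | c , e = c , e

  Edge-alike-at : ∀ c {x y y′} → Edge c x y → Edge c x y′ → SameOrbit Γ G x y x y′
  Edge-alike-at red refl refl = SameOrbit-refl _ _
  Edge-alike-at blue (b , refl) (b′ , refl) = β-alike b b′ _

  Edge-alike : ∀ c {u v x y} → Edge c u v → Edge c x y → SameOrbit Γ G u v x y
  Edge-alike c {u} {v} {x} uv xy with vt u x
  ... | g , Gg , refl = SameOrbit-trans (SameOrbit-image Gg refl refl) (Edge-alike-at c (Edge-image Gg c uv) xy)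

  ρ-involutive : ∀ x → ρ (ρ x) ≡ x
  ρ-involutive x with ρ-or-β (ρ x) x (~-sym (adj-ρ x))
  ... | inj₁ x≡ρρ = sym x≡ρρ
  ... | inj₂ (b , x≡β) = ⊥-elim (ρβ-unalike b (ρ x)
          (SameOrbit-trans (Edge-alike red refl refl)
            (subst (SameOrbit Γ G x (ρ x) (ρ x)) x≡β (SameOrbit-swap x (ρ x)))))

  Edge-sym : ∀ c {u v} → Edge c u v → Edge c v u
  Edge-sym red {u} refl = sym (ρ-involutive u)
  Edge-sym blue {u} (b , refl) = ≢ρ⇒β (β b u) u (~-sym (adj-β b u))
    (λ u≡ρ → ρ≢β b u (trans (cong ρ u≡ρ) (ρ-involutive (β b u))))

  Edge-unalike : ∀ c {u v x y} → Edge c u v → Edge (other c) x y → ¬ SameOrbit Γ G u v x y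
  Edge-unalike c uv xy (h , Gh , inj₁ (refl , refl)) = ≢other c (Edge-unique (Edge-image Gh c uv) xy)
  Edge-unalike c uv xy (h , Gh , inj₂ (refl , refl)) = ≢other c (Edge-unique (Edge-sym c (Edge-image Gh c uv)) xy)

  -- Walks of this digraph are the alternating walks of Γ starting with a red edge.
  _⇒_ : V → V → Set
  x ⇒ y = Edge blue (ρ x) y

  ⇒-image : ∀ {g} → G g → ∀ {x y} → x ⇒ y → to g x ⇒ to g y
  ⇒-image Gg {x} xy = subst (λ r → Edge blue r _) (ρ-equivariant Gg x) (Edge-image Gg blue xy)

  ⇒-reverse : ∀ {x y} → x ⇒ y → ρ y ⇒ ρ x
  ⇒-reverse {y = y} xy = subst (λ r → Edge blue r _) (sym (ρ-involutive y)) (Edge-sym blue xy)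

  ρ-fixed : ∀ {f} → G f → ∀ {x} → to f x ≡ x → to f (ρ x) ≡ ρ x
  ρ-fixed Gf {x} fx = trans (ρ-equivariant Gf x) (cong ρ fx)

  fixes-or-swaps-successors : ∀ {f} → G f → ∀ {y} → to f y ≡ y →
    (∀ b → to f (β b (ρ y)) ≡ β b (ρ y)) ⊎ (∀ b → to f (β b (ρ y)) ≡ β (not b) (ρ y))
  fixes-or-swaps-successors {f} Gf {y} fy
    with β-equivariant Gf true (ρ y) | β-equivariant Gf false (ρ y)
  ... | c₁ , e₁ | c₂ , e₂ = by-cases c₁ c₂ (subst (λ r → to f _ ≡ β c₁ r) (ρ-fixed Gf fy) e₁)
                                           (subst (λ r → to f _ ≡ β c₂ r) (ρ-fixed Gf fy) e₂)
    where
    by-cases : ∀ c₁ c₂ → to f (β true (ρ y)) ≡ β c₁ (ρ y) → to f (β false (ρ y)) ≡ β c₂ (ρ y) →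
      (∀ b → to f (β b (ρ y)) ≡ β b (ρ y)) ⊎ (∀ b → to f (β b (ρ y)) ≡ β (not b) (ρ y))
    by-cases true true e₁ e₂ = ⊥-elim (β-distinct true (ρ y) (to-injective f (trans e₁ (sym e₂))))
    by-cases true false e₁ e₂ = inj₁ λ { true → e₁ ; false → e₂ }
    by-cases false true e₁ e₂ = inj₂ λ { true → e₁ ; false → e₂ }
    by-cases false false e₁ e₂ = ⊥-elim (β-distinct true (ρ y) (to-injective f (trans e₁ (sym e₂))))

  fixes-successors : ∀ {f} → G f → ∀ {y a z} → to f y ≡ y → y ⇒ a → to f a ≡ a → y ⇒ z → to f z ≡ z
  fixes-successors Gf fy (i , refl) fa (j , refl) with fixes-or-swaps-successors Gf fy
  ... | inj₁ fixes = fixes j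
  ... | inj₂ swaps = ⊥-elim (β-distinct i _ (trans (sym fa) (swaps i)))


  swaps-successors : ∀ {f} → G f → ∀ {y z a b} → to f y ≡ y → y ⇒ z → to f z ≢ z →
    y ⇒ a → y ⇒ b → a ≢ b → to f a ≡ b
  swaps-successors Gf {y} fy yz fz≢z (i , refl) (j , refl) a≢b with fixes-or-swaps-successors Gf fy
  ... | inj₁ fixes = ⊥-elim (fz≢z (fixes-successors Gf fy (true , refl) (fixes true) yz))
  ... | inj₂ swaps = trans (swaps i) (cong (λ c → β c (ρ y)) (sym (¬-not {j} {i} j≢i)))
    where
    j≢i : j ≢ i
    j≢i = a≢b ∘′ cong (λ c → β c (ρ y)) ∘′ sym

  -- A walk of length k is listed backwards, w k ⇒ ⋯ ⇒ w 1 ⇒ w 0, so that it is extended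
  -- at its end by _◂_.
  Walk : ℕ → (ℕ → V) → Set
  Walk k w = ∀ i → i < k → w (suc i) ⇒ w i

  Fixes : Aut Γ → ℕ → (ℕ → V) → Set
  Fixes f k w = ∀ i → i ≤ k → to f (w i) ≡ w i

  Maps : Aut Γ → ℕ → (ℕ → V) → (ℕ → V) → Set
  Maps g k w w′ = ∀ i → i ≤ k → to g (w i) ≡ w′ i

  SuccessorMoved : ℕ → (ℕ → V) → Set
  SuccessorMoved k w = Σ (Aut Γ) λ f → G f × Fixes f k w × Σ V λ z → w 0 ⇒ z × to f z ≢ z

  SuccessorsFixed : ℕ → Set
  SuccessorsFixed k = ∀ w → Walk k w → ∀ f → G f → Fixes f k w → ∀ z → w 0 ⇒ z → to f z ≡ z

  WalksTransitive : ℕ → Set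
  WalksTransitive k = ∀ w w′ → Walk k w → Walk k w′ → Σ (Aut Γ) λ g → G g × Maps g k w w′

  walk-tail : ∀ {k w} → Walk (suc k) w → Walk k (w ∘ suc)
  walk-tail W i i<k = W (suc i) (s≤s i<k)

  walk-◂ : ∀ {k w z} → Walk k w → w 0 ⇒ z → Walk (suc k) (z ◂ w)
  walk-◂ W wz zero _ = wz
  walk-◂ W wz (suc i) (s≤s i<k) = W i i<k

  walk-weaken : ∀ {k w} → Walk (suc k) w → Walk k w
  walk-weaken W i i<k = W i (m<n⇒m<1+n i<k)

  fixes-◂ : ∀ {f k w z} → Fixes f k w → to f z ≡ z → Fixes f (suc k) (z ◂ w)
  fixes-◂ F fz zero _ = fz
  fixes-◂ F fz (suc i) (s≤s i≤k) = F i i≤k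

  fixes-weaken : ∀ {f k w} → Fixes f (suc k) w → Fixes f k w
  fixes-weaken F i i≤k = F i (m≤n⇒m≤1+n i≤k)

  maps-suc : ∀ {g k w w′} → to g (w 0) ≡ w′ 0 → Maps g k (w ∘ suc) (w′ ∘ suc) → Maps g (suc k) w w′
  maps-suc g-end m zero _ = g-end
  maps-suc g-end m (suc i) (s≤s i≤k) = m i i≤k

  walksTransitive-zero : WalksTransitive 0
  walksTransitive-zero w w′ _ _ with vt (w 0) (w′ 0)
  ... | g , Gg , gw = g , Gg , λ { zero z≤n → gw }

  -- If g already sends the end of w to the end of w′ we are done; otherwise g (w 0) and w′ 0 are
  -- the two successors of w′ 1, and an element fixing w′ ∘ suc but moving a successor swaps them.
  walksTransitive-suc : ∀ k → WalksTransitive k → (∀ w → Walk k w → SuccessorMoved k w) →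
    WalksTransitive (suc k)
  walksTransitive-suc k transitive moved w w′ W W′
    with transitive (w ∘ suc) (w′ ∘ suc) (walk-tail W) (walk-tail W′)
  ... | g , Gg , g-maps with em {to g (w 0) ≡ w′ 0}
  ... | yes g-end = g , Gg , maps-suc {g} {w = w} g-end g-maps
  ... | no g-end≢ with moved (w′ ∘ suc) (walk-tail W′)
  ... | f , Gf , f-fixes , z , w′₁⇒z , fz≢z =
    _∘A_ Γ f g , ∘-closed Gf Gg , maps-suc {_∘A_ Γ f g} {w = w} fg-end fg-maps
    where
    w′₁⇒gw₀ : w′ 1 ⇒ to g (w 0)
    w′₁⇒gw₀ = subst (_⇒ to g (w 0)) (g-maps 0 z≤n) (⇒-image Gg (W 0 (s≤s z≤n)))
    fg-end : to f (to g (w 0)) ≡ w′ 0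
    fg-end = swaps-successors Gf (f-fixes 0 z≤n) w′₁⇒z fz≢z w′₁⇒gw₀ (W′ 0 (s≤s z≤n)) g-end≢
    fg-maps : Maps (_∘A_ Γ f g) k (w ∘ suc) (w′ ∘ suc)
    fg-maps i i≤k = trans (cong (to f) (g-maps i i≤k)) (f-fixes i i≤k)

  -- Conjugating by an element of G carrying w to w₀ would make w₀ satisfy SuccessorMoved.
  successorsFixed : ∀ k → WalksTransitive k → ∀ w₀ → Walk k w₀ → ¬ SuccessorMoved k w₀ → SuccessorsFixed k
  successorsFixed k transitive w₀ W₀ ¬moved w W f Gf f-fixes z wz with em {to f z ≡ z}
  ... | yes fz = fz
  ... | no fz≢z with transitive w w₀ W W₀
  ... | g , Gg , g-maps = ⊥-elim (¬moved (h , Gh , h-fixes , to g z , w₀⇒gz , hgz≢gz))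
    where
    h : Aut Γ
    h = _∘A_ Γ (_∘A_ Γ g f) (invAut Γ g)
    Gh : G h
    Gh = ∘-closed (∘-closed Gg Gf) (inv-closed Gg)
    h-fixes : Fixes h k w₀
    h-fixes i i≤k = begin
      to g (to f (from g (w₀ i))) ≡⟨ cong (to g ∘ to f) (from-inverse g (g-maps i i≤k)) ⟩
      to g (to f (w i))           ≡⟨ cong (to g) (f-fixes i i≤k) ⟩
      to g (w i)                  ≡⟨ g-maps i i≤k ⟩
      w₀ i                        ∎
    w₀⇒gz : w₀ 0 ⇒ to g z
    w₀⇒gz = subst (_⇒ to g z) (g-maps 0 z≤n) (⇒-image Gg wz)
    hgz≢gz : to h (to g z) ≢ to g z
    hgz≢gz e = fz≢z (to-injective g (trans (cong (to g ∘ to f) (sym (from-to g z))) e))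

  straight : V → ℕ → V
  straight y zero = y
  straight y (suc i) = β true (ρ (straight y i))

  module Anchoring {k} (fixed : SuccessorsFixed k) {f} (Gf : G f) where

    Anchored : V → Set
    Anchored y = Σ (ℕ → V) λ u → Walk k u × Fixes f k u × u 0 ≡ y

    anchored-fixed : ∀ {y} → Anchored y → to f y ≡ y
    anchored-fixed (u , _ , F , refl) = F 0 z≤n

    anchored-successor : ∀ {y z} → Anchored y → y ⇒ z → Anchored z
    anchored-successor {z = z} (u , W , F , refl) uz =
      z ◂ u , walk-weaken (walk-◂ {w = u} W uz) ,
      fixes-weaken {f} (fixes-◂ {f} {w = u} F (fixed u W _ Gf F z uz)) , refl

    anchored-straight : ∀ {y} → Anchored y → ∀ i → Anchored (straight y i)
    anchored-straight a zero = a
    anchored-straight a (suc i) = anchored-successor (anchored-straight a i) (true , refl)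

    -- Reversing the straight walk from y through ρ gives a fixed walk ending at ρ y.
    anchored-ρ : ∀ {y} → Anchored y → Anchored (ρ y)
    anchored-ρ {y} a = ρ ∘ straight y , (λ i _ → ⇒-reverse (true , refl)) ,
                       (λ i _ → ρ-fixed Gf (anchored-fixed (anchored-straight a i))) , refl

    anchored-neighbour : ∀ {y z} → Anchored y → y ~ z → Anchored z
    anchored-neighbour {y} a yz with ρ-or-β y _ yz
    ... | inj₁ refl = anchored-ρ a
    ... | inj₂ (b , refl) = anchored-successor (anchored-ρ a) (b , cong (β b) (sym (ρ-involutive y)))

    anchored-reachable : ∀ {y z} → Star _~_ y z → Anchored y → Anchored z
    anchored-reachable ε a = a
    anchored-reachable (yw ◅ wz) a = anchored-reachable wz (anchored-neighbour a yw)

  fixes-walk⇒fixes-all : ∀ k → SuccessorsFixed k → ∀ {f w} → G f → Walk k w → Fixes f k w → ∀ x → to f x ≡ x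
  fixes-walk⇒fixes-all k fixed {w = w} Gf W F x =
    anchored-fixed (anchored-reachable (connected (w 0) x) (w , W , F , refl))
    where open Anchoring fixed Gf

  successorWalk : Bool → (ℕ → V) → ℕ → V
  successorWalk b w = β b (ρ (w 0)) ◂ w

  walksFrom : V → ℕ → List (ℕ → V)
  walksFrom v zero = (λ _ → v) ∷ []
  walksFrom v (suc k) = map (successorWalk true) (walksFrom v k) ++ map (successorWalk false) (walksFrom v k)

  Agree : ℕ → (ℕ → V) → (ℕ → V) → Set
  Agree k w u = ∀ i → i ≤ k → w i ≡ u i

  walksFrom-complete : ∀ {v} k u → Walk k u → u k ≡ v → Any (λ w → Agree k w u) (walksFrom v k)
  walksFrom-complete zero u _ refl = here λ { zero z≤n → refl }
  walksFrom-complete {v} (suc k) u W start with W 0 (s≤s z≤n)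
  ... | b , u₀≡β = place b (Any.map agree-suc (walksFrom-complete k (u ∘ suc) (walk-tail W) start))
    where
    agree-suc : ∀ {w} → Agree k w (u ∘ suc) → Agree (suc k) (successorWalk b w) u
    agree-suc agree zero _ = trans (cong (λ y → β b (ρ y)) (agree 0 z≤n)) (sym u₀≡β)
    agree-suc agree (suc i) (s≤s i≤k) = agree i i≤k
    place : ∀ b → Any (λ w → Agree (suc k) (successorWalk b w) u) (walksFrom v k) →
            Any (λ w → Agree (suc k) w u) (walksFrom v (suc k))
    place true found = ++⁺ˡ (map⁺ found)
    place false found = ++⁺ʳ (map (successorWalk true) (walksFrom v k)) (map⁺ found)

  reference : V → ℕ → ℕ → V
  reference v zero = λ _ → v
  reference v (suc k) = successorWalk true (reference v k)

  reference-walk : ∀ v k → Walk k (reference v k)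
  reference-walk v (suc k) zero _ = true , refl
  reference-walk v (suc k) (suc i) (s≤s i<k) = reference-walk v k i i<k

  reference-start : ∀ v k → reference v k k ≡ v
  reference-start v zero = refl
  reference-start v (suc k) = reference-start v k

  successorsFixed⇒finiteStabiliser : ∀ k → SuccessorsFixed k → ∀ v → FiniteStabilizer Γ G v
  successorsFixed⇒finiteStabiliser k fixed v =
    map (λ w → chosen w (em {Reaches w})) (walksFrom v k) , λ g Gg gv →
      map⁺ (Any.map (same-as-chosen Gg) (walksFrom-complete k (to g ∘ P) (image-walk Gg)
                                           (trans (cong (to g) (reference-start v k)) gv)))
    where
    P : ℕ → V
    P = reference v k

    image-walk : ∀ {g} → G g → Walk k (to g ∘ P)
    image-walk Gg i i<k = ⇒-image Gg (reference-walk v k i i<k)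

    Reaches : (ℕ → V) → Set
    Reaches w = Σ (Aut Γ) λ h → G h × Maps h k P w

    chosen : ∀ w → Dec (Reaches w) → Aut Γ
    chosen w (yes (h , _)) = h
    chosen w (no _) = idAut Γ

    chosen-reaches : ∀ w d → Reaches w → G (chosen w d) × Maps (chosen w d) k P w
    chosen-reaches w (yes (h , Gh , h-maps)) _ = Gh , h-maps
    chosen-reaches w (no ¬reaches) r = ⊥-elim (¬reaches r)

    same-as-chosen : ∀ {g} → G g → ∀ {w} → Agree k w (to g ∘ P) →
                     ∀ x → to g x ≡ to (chosen w (em {Reaches w})) x
    same-as-chosen {g} Gg {w} agree x
      with chosen-reaches w (em {Reaches w}) (g , Gg , λ i i≤k → sym (agree i i≤k))
    ... | Gh , h-maps =
      trans (sym (to-from h (to g x))) (cong (to h) (fixes-walk⇒fixes-all k fixed Gf (reference-walk v k) f-fixes x))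
      where
      h : Aut Γ
      h = chosen w (em {Reaches w})
      f : Aut Γ
      f = _∘A_ Γ (invAut Γ h) g
      Gf : G f
      Gf = ∘-closed (inv-closed Gh) Gg
      f-fixes : Fixes f k P
      f-fixes i i≤k = from-inverse h (trans (h-maps i i≤k) (agree i i≤k))

  walksTransitive : ∀ k → WalksTransitive k
  successorMoved : ∀ k w → Walk k w → SuccessorMoved k w

  walksTransitive zero = walksTransitive-zero
  walksTransitive (suc k) = walksTransitive-suc k (walksTransitive k) (successorMoved k)

  successorMoved k w W with em {SuccessorMoved k w}
  ... | yes moved = moved
  ... | no ¬moved = ⊥-elim (infinite (w 0) (successorsFixed⇒finiteStabiliser k
                      (successorsFixed k (walksTransitive k) w W ¬moved) (w 0)))

  walk-avoids-start : ∀ m w → Walk (suc m) w → w 0 ≢ w (suc m) × w 0 ≢ ρ (w (suc m))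
  walk-avoids-start m w W with successorMoved m (w ∘ suc) (walk-tail W)
  ... | f , Gf , f-fixes , z , w₁⇒z , fz≢z =
    moved-if-fixed ∘′ end-fixed-if-start , moved-if-fixed ∘′ end-fixed-if-ρ-start
    where
    moved-if-fixed : to f (w 0) ≡ w 0 → ⊥
    moved-if-fixed fw₀ = fz≢z (fixes-successors Gf (f-fixes 0 z≤n) (W 0 (s≤s z≤n)) fw₀ w₁⇒z)
    start-fixed : to f (w (suc m)) ≡ w (suc m)
    start-fixed = f-fixes m ≤-refl
    end-fixed-if-start : w 0 ≡ w (suc m) → to f (w 0) ≡ w 0
    end-fixed-if-start e = subst (λ y → to f y ≡ y) (sym e) start-fixed
    end-fixed-if-ρ-start : w 0 ≡ ρ (w (suc m)) → to f (w 0) ≡ w 0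
    end-fixed-if-ρ-start e = subst (λ y → to f y ≡ y) (sym e) (ρ-fixed Gf start-fixed)

  Beyond : V → V → Set
  Beyond x y = TransClosure _⇒_ x y ⊎ TransClosure _⇒_ x (ρ y)

  path-reversed-walk : ∀ {x y} → TransClosure _⇒_ x y →
    Σ ℕ λ m → Σ (ℕ → V) λ w → Walk (suc m) w × w 0 ≡ ρ x × w (suc m) ≡ ρ y
  path-reversed-walk {x} {y} [ xy ] =
    0 , ρ x ◂ (λ _ → ρ y) , (λ { zero _ → ⇒-reverse xy ; (suc i) (s≤s ()) }) , refl , refl
  path-reversed-walk {x} (xz ∷ zy) with path-reversed-walk zy
  ... | m , w , W , w-end , w-start =
    suc m , ρ x ◂ w , walk-◂ {w = w} W (subst (_⇒ ρ x) (sym w-end) (⇒-reverse xz)) , refl , w-start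

  path-avoids-start : ∀ {x y} → TransClosure _⇒_ x y → y ≢ x × y ≢ ρ x
  path-avoids-start {x} {y} p with path-reversed-walk p
  ... | m , w , W , w-end , w-start with walk-avoids-start m w W
  ... | end≢start , end≢ρstart = end≢start ∘′ returns , end≢ρstart ∘′ returns-to-ρ
    where
    returns : y ≡ x → w 0 ≡ w (suc m)
    returns y≡x = begin
      w 0       ≡⟨ w-end ⟩
      ρ x       ≡⟨ cong ρ (sym y≡x) ⟩
      ρ y       ≡⟨ sym w-start ⟩
      w (suc m) ∎
    returns-to-ρ : y ≡ ρ x → w 0 ≡ ρ (w (suc m))
    returns-to-ρ y≡ρx = begin
      w 0             ≡⟨ w-end ⟩
      ρ x             ≡⟨ sym y≡ρx ⟩
      y               ≡⟨ sym (ρ-involutive y) ⟩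
      ρ (ρ y)         ≡⟨ cong ρ (sym w-start) ⟩
      ρ (w (suc m))   ∎

  beyond-avoids-start : ∀ {x y} → Beyond x y → y ≢ x × y ≢ ρ x
  beyond-avoids-start (inj₁ p) = path-avoids-start p
  beyond-avoids-start {x} {y} (inj₂ p) with path-avoids-start p
  ... | ρy≢x , ρy≢ρx = (ρy≢ρx ∘′ cong ρ) , (λ y≡ρx → ρy≢x (trans (cong ρ y≡ρx) (ρ-involutive x)))

  AltFrom : Colour → (ℕ → V) → Set
  AltFrom c γ = ∀ j → Edge (colourAt c j) (γ j) (γ (suc j))

  red-step : ∀ {γ} → AltFrom red γ → γ 0 ⇒ γ 2
  red-step {γ} A = subst (λ r → Edge blue r (γ 2)) (A 0) (A 1)

  -- γ 0, ρ (γ 0) = γ 1, γ 2, ρ (γ 2) = γ 3, … : the even terms form a walk of the digraph.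
  red-beyond : ∀ {γ} → AltFrom red γ → ∀ j → Beyond (γ 0) (γ (2 + j))
  red-beyond A zero = inj₁ [ red-step A ]
  red-beyond {γ} A (suc zero) =
    inj₂ [ subst (γ 0 ⇒_) (sym (trans (cong ρ (A 2)) (ρ-involutive (γ 2)))) (red-step A) ]
  red-beyond A (suc (suc j)) with red-beyond (λ i → A (suc (suc i))) j
  ... | inj₁ p = inj₁ (red-step A ∷ p)
  ... | inj₂ p = inj₂ (red-step A ∷ p)

  alt-no-return : ∀ c {γ} → AltFrom c γ → ∀ j → γ (suc j) ≢ γ 0
  alt-no-return c {γ} A zero γ₁≡γ₀ = ~-irrefl (subst (γ 0 ~_) γ₁≡γ₀ (Edge-adjacent c (A 0)))
  alt-no-return red A (suc j) = proj₁ (beyond-avoids-start (red-beyond A j))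
  alt-no-return blue {γ} A (suc j) γ≡γ₀ =
    proj₂ (beyond-avoids-start (red-beyond ρ-prefixed (suc j))) (trans γ≡γ₀ (sym (ρ-involutive (γ 0))))
    where
    ρ-prefixed : AltFrom red (ρ (γ 0) ◂ γ)
    ρ-prefixed zero = sym (ρ-involutive (γ 0))
    ρ-prefixed (suc i) = A i

  step : Colour → Bool → V → V
  step red _ x = ρ x
  step blue b x = β b x

  step-edge : ∀ c b x → Edge c x (step c b x)
  step-edge red _ x = refl
  step-edge blue b x = b , refl

  edge-step : ∀ c {x y} → Edge c x y → Σ Bool λ b → y ≡ step c b x
  edge-step red e = true , e
  edge-step blue e = e

  -- choice n selects the blue neighbour when the n-th edge is blue, and is ignored otherwise.
  alternating : V → Colour → (ℕ → Bool) → ℕ → V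
  alternating x c choice zero = x
  alternating x c choice (suc n) = alternating (step c (choice 0) x) (other c) (choice ∘ suc) n

  alternating-alt : ∀ x c choice → AltFrom c (alternating x c choice)
  alternating-alt x c choice zero = step-edge c (choice 0) x
  alternating-alt x c choice (suc j) = alternating-alt (step c (choice 0) x) (other c) (choice ∘ suc) j

  next-colour : ∀ c {u v w} → Edge c u v → v ~ w → ¬ SameOrbit Γ G u v v w → Edge (other c) v w
  next-colour c uv vw unalike with colourOf vw
  next-colour red uv vw unalike | red , vw′ = ⊥-elim (unalike (Edge-alike red uv vw′))
  next-colour red uv vw unalike | blue , vw′ = vw′
  next-colour blue uv vw unalike | red , vw′ = vw′
  next-colour blue uv vw unalike | blue , vw′ = ⊥-elim (unalike (Edge-alike blue uv vw′))

  arc-tail : ∀ {s α} → AltArc Γ G (suc s) α → AltArc Γ G s (α ∘ suc)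
  arc-tail (adjacent , distinct , unalike) =
    (λ i i<s → adjacent (suc i) (s≤s i<s)) , (λ i i<s → distinct (suc i) (s≤s i<s)) ,
    (λ i i<s → unalike (suc i) (s≤s i<s))

  arc-alternating : ∀ s α → AltArc Γ G s α → ∀ c → (0 < s → Edge c (α 0) (α 1)) →
    Σ (ℕ → Bool) λ choice → ∀ i → i ≤ s → alternating (α 0) c choice i ≡ α i
  arc-alternating zero α _ c _ = (λ _ → true) , λ { zero z≤n → refl }
  arc-alternating (suc s) α arc@(adjacent , _ , unalike) c first with edge-step c (first (s≤s z≤n))
  ... | b , α₁≡step with arc-alternating s (α ∘ suc) (arc-tail arc) (other c) second
    where
    second : 0 < s → Edge (other c) (α 1) (α 2)
    second 0<s = next-colour c (first (s≤s z≤n)) (adjacent 1 (s≤s 0<s)) (unalike 0 (s≤s 0<s))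
  ... | choice , agree = (b ◂ choice) , λ
    { zero _ → refl
    ; (suc i) (s≤s i≤s) → trans (cong (λ y → alternating y (other c) choice i) (sym α₁≡step)) (agree i i≤s) }

  LocallyAlternating : (ℤ → V) → Set
  LocallyAlternating L = ∀ i → Σ Colour λ d →
    Edge d (L i) (L (i ℤ.+ + 1)) × Edge (other d) (L (i ℤ.+ + 1)) (L (i ℤ.+ + 2))

  locally⇒alt : ∀ {L} → LocallyAlternating L → ∀ c a → Edge c (L a) (L (a ℤ.+ + 1)) →
    AltFrom c (λ t → L (a ℤ.+ + t))
  locally⇒alt {L} loc c a first zero = subst (λ i → Edge c (L i) (L (a ℤ.+ + 1))) (sym (ℤP.+-identityʳ a)) first
  locally⇒alt {L} loc c a first (suc j) with loc a
  ... | d , first′ , second rewrite Edge-unique first′ first =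
    subst₂ (λ p q → Edge (colourAt c (suc j)) (L p) (L q)) (ℤP.+-assoc a (+ 1) (+ j)) (ℤP.+-assoc a (+ 1) (+ suc j))
      (locally⇒alt loc (other c) (a ℤ.+ + 1) second′ j)
    where
    second′ : Edge (other c) (L (a ℤ.+ + 1)) (L ((a ℤ.+ + 1) ℤ.+ + 1))
    second′ = subst (λ i → Edge (other c) (L (a ℤ.+ + 1)) (L i)) (sym (ℤP.+-assoc a (+ 1) (+ 1))) second

  locally-no-return : ∀ {L} → LocallyAlternating L → ∀ a n → L (a ℤ.+ + suc n) ≢ L a
  locally-no-return {L} loc a n returns with loc a
  ... | d , first , _ = alt-no-return d (locally⇒alt loc d a first) n
                          (trans returns (cong L (sym (ℤP.+-identityʳ a))))

  locally⇒injective : ∀ {L} → LocallyAlternating L → ∀ a b → L a ≡ L b → a ≡ b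
  locally⇒injective {L} loc a b La≡Lb with ℤ-split a b
  ... | inj₁ a≡b = a≡b
  ... | inj₂ (inj₁ (n , refl)) = ⊥-elim (locally-no-return loc a n (sym La≡Lb))
  ... | inj₂ (inj₂ (n , refl)) = ⊥-elim (locally-no-return loc b n La≡Lb)

  locally⇒AltLine : ∀ {L} → LocallyAlternating L → AltLine Γ G L
  locally⇒AltLine loc = (λ {a} {b} → locally⇒injective loc a b) ,
    (λ i → Edge-adjacent _ (proj₁ (proj₂ (loc i)))) ,
    (λ i → Edge-unalike (proj₁ (loc i)) (proj₁ (proj₂ (loc i))) (proj₂ (proj₂ (loc i))))

  line : V → Colour → (ℕ → Bool) → (ℕ → Bool) → ℤ → V
  line x c forward backward (+ n) = alternating x c forward n
  line x c forward backward -[1+ n ] = alternating x (other c) backward (suc n)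

  line-locallyAlternating : ∀ x c forward backward → LocallyAlternating (line x c forward backward)
  line-locallyAlternating x c forward backward = local
    where
    F = alternating x c forward
    B = alternating x (other c) backward

    forward-pair : ∀ n → Edge (colourAt c n) (F n) (F (suc n)) × Edge (other (colourAt c n)) (F (suc n)) (F (2 + n))
    forward-pair n = alternating-alt x c forward n ,
                     subst (λ d → Edge d (F (suc n)) (F (2 + n))) (colourAt-suc c n) (alternating-alt x c forward (suc n))

    backward-pair : ∀ n → Σ Colour λ d → Edge d (B (2 + n)) (B (suc n)) × Edge (other d) (B (suc n)) (B n)
    backward-pair n = colourAt (other c) (suc n) ,
      Edge-sym _ (alternating-alt x (other c) backward (suc n)) ,
      subst (λ d → Edge d (B (suc n)) (B n)) (sym (trans (cong other (colourAt-suc (other c) n)) (other-involutive _)))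
        (Edge-sym _ (alternating-alt x (other c) backward n))

    local : LocallyAlternating (line x c forward backward)
    local (+ n) rewrite ℕ.+-comm n 1 | ℕ.+-comm n 2 = colourAt c n , forward-pair n
    local -[1+ zero ] = other c , Edge-sym _ (alternating-alt x (other c) backward 0) ,
      subst (λ d → Edge d x (F 1)) (sym (other-involutive c)) (alternating-alt x c forward 0)
    local -[1+ suc zero ] = backward-pair 0
    local -[1+ suc (suc m) ] = backward-pair (suc m)

  first-colour : ∀ s α → AltArc Γ G s α → Σ Colour λ c → 0 < s → Edge c (α 0) (α 1)
  first-colour zero α _ = red , λ ()
  first-colour (suc s) α (adjacent , _) with colourOf (adjacent 0 (s≤s z≤n))
  ... | c , first = c , λ _ → first

  alternating-line-through : ∀ s α → AltArc Γ G s α → Σ (ℤ → V) λ L → AltLine Γ G L × ArcInLine Γ s α L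
  alternating-line-through s α arc with first-colour s α arc
  ... | c , first with arc-alternating s α arc c first
  ... | choice , agree =
    line (α 0) c choice (λ _ → true) , locally⇒AltLine (line-locallyAlternating _ _ _ _) , + 0 , agree

  -- Without vertices, G would be edge-transitive vacuously.
  some-vertex : V
  some-vertex with em {V}
  ... | yes v = v
  ... | no ¬v = ⊥-elim (¬et λ u → ⊥-elim (¬v u))

  alternating-line : Σ (ℤ → V) λ L → AltLine Γ G L
  alternating-line with alternating-line-through 0 (λ _ → some-vertex) ((λ _ ()) , (λ _ ()) , (λ _ ()))
  ... | L , alt , _ = L , alt

corollary4p8 : ExcludedMiddle 0ℓ →
    (Γ : Graph) → Connected Γ → Trivalent Γ →
    (G : Aut Γ → Set) → IsSubgroup Γ G →
    VertexTransitive Γ G → ¬ EdgeTransitive Γ G →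
    (∀ v → InfiniteStabilizer Γ G v) →
    (Σ (ℤ → Graph.V Γ) λ L → AltLine Γ G L) ×
    (∀ s α → AltArc Γ G s α → Σ (ℤ → Graph.V Γ) λ L → AltLine Γ G L × ArcInLine Γ s α L)
corollary4p8 em Γ connected trivalent G sub vt ¬et infinite = alternating-line , alternating-line-through
  where open VertexNotEdgeTransitive em connected trivalent sub vt ¬et infinite
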